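{- Let $f(x), g(x) \in \mathbf{Z}[x]$ with $g \neq 0$. Then there exist a positive integer $T$ and polynomials $p_i(x), r_i(x) \in \mathbf{Z}[x]$ for $i = 0, \dots, T-1$ such that for all sufficiently large $n$, writing $n = Tm + i$ with $0 \le i \le T-1$, \[ p_i(m) = \left\lfloor \frac{f(n)}{g(n)} \right\rfloor \quad \text{and} \quad r_i(m) = \left\{ \frac{f(n)}{g(n)} \right\} g(n). \]
   Context: For a real number $y$, $\lfloor y \rfloor$ is the greatest integer at most $y$ and $\{y\} = y - \lfloor y \rfloor$ is its fractional part. -}

module Defs where

open import Data.Nat using (ℕ; suc)
open import Data.Integer as ℤ using (ℤ; +_; +[1+_]; -[1+_]; 0ℤ)
open import Data.Rational as ℚ using (ℚ; floor; _/_)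
open import Data.List using (List; []; _∷_)
open import Data.List.Relation.Unary.Any using (Any)
open import Relation.Binary.PropositionalEquality using (_≢_)

-- Polynomials in ℤ[x] as coefficient lists, lowest degree first:
-- a₀ ∷ a₁ ∷ … represents a₀ + a₁ x + …
Poly : Set
Poly = List ℤ

eval : Poly → ℤ → ℤ
eval [] x = 0ℤ
eval (a ∷ as) x = a ℤ.+ x ℤ.* eval as x

NonZeroPoly : Poly → Set
NonZeroPoly g = Any (λ c → c ≢ 0ℤ) g

-- The rational number a / b (with the junk value 0 when b = 0).
ratio : ℤ → ℤ → ℚ
ratio a (+ 0) = ℚ.0ℚ
ratio a +[1+ k ] = a / suc k
ratio a -[1+ k ] = (ℤ.- a) / suc k

frac : ℚ → ℚ
frac y = y ℚ.- (floor y / 1)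

module Submission where

-- Negating f and g changes nothing, so assume g = glo + (c+1)·x^d with deg glo < d.
-- Pseudo-division gives T·f = q·g + r with T > 0 and deg r < d.  The leading term of g
-- dominates r, so −g(n) < r(n) < g(n) eventually, and r has eventually constant sign; moving
-- one g into the quotient if r is eventually negative yields T·f(n) = Q(n)·g(n) + s(n) with
-- 0 ≤ s(n) < g(n).  On the class n = T·m + i we have Q(n) = Q(i) + T·ΔQ(m) and
-- Q(i) = T·aᵢ + bᵢ with 0 ≤ bᵢ < T, hence ⌊f(n)/g(n)⌋ = ΔQ(m) + aᵢ.  The remainder is then
-- f(T·m + i) − g(T·m + i)·p_i(m), visibly a polynomial in m.

open import Defs

module IntegerFloor where

  open import Data.Nat as ℕ using (zero; suc)
  import Data.Nat.Properties as ℕP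
  open import Data.Integer as ℤ
    using (ℤ; +_; +[1+_]; -[1+_]; 0ℤ; 1ℤ; _+_; _*_; -_; _-_; _≤_; _<_; +<+)
  open import Data.Integer.Properties
  open import Data.Integer.DivMod using (a≡a%n+[a/n]*n; n%d<d)
  open import Data.Integer.Tactic.RingSolver using (solve-∀)
  open import Data.Product using (_×_; _,_)
  open import Data.Rational as ℚ using (mkℚ; floor; _/_; ↥_; ↧_)
  open import Data.Rational.Properties using (↥-/; ↧-/; toℚᵘ-injective; toℚᵘ-fromℚᵘ; toℚᵘ-homo-+; toℚᵘ-homo-*; toℚᵘ-homo‿-)
  import Data.Rational.Unnormalised as ℚᵘ
  import Data.Rational.Unnormalised.Properties as ℚᵘP
  open import Relation.Binary.PropositionalEquality
  open import Relation.Nullary using (contradiction)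

  InBracket : ℤ → ℤ → ℤ → Set
  InBracket d z a = z * d ≤ a × a < (z + 1ℤ) * d

  bracket-unique : ∀ {d a z w} → 0ℤ < d → InBracket d z a → InBracket d w a → z ≡ w
  bracket-unique {+ zero} (+<+ ()) _ _
  bracket-unique {+[1+ k ]} _ (zd≤a , a<z+1d) (wd≤a , a<w+1d) =
    ≤-antisym (below (≤-<-trans zd≤a a<w+1d)) (below (≤-<-trans wd≤a a<z+1d))
    where
    below : ∀ {x y} → x * +[1+ k ] < (y + 1ℤ) * +[1+ k ] → x ≤ y
    below {x} {y} p = subst (x ≤_) (pred-suc y)
      (i<j⇒i≤pred[j] (subst (x <_) (+-comm y 1ℤ) (*-cancelʳ-<-nonNeg +[1+ k ] p)))

  quotient-bracket : ∀ a k → InBracket +[1+ k ] (a ℤ./ +[1+ k ]) a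
  quotient-bracket a k = lower , upper
    where
    d = +[1+ k ]
    w = a ℤ./ d
    r = + (a ℤ.% d)
    a≡ : a ≡ r + w * d
    a≡ = a≡a%n+[a/n]*n a d
    lower : w * d ≤ a
    lower = subst (w * d ≤_) (sym a≡) (i≤j⇒i≤k+j r ≤-refl)
    upper : a < (w + 1ℤ) * d
    upper = subst₂ _<_ (sym a≡) (shift w d) (+-monoˡ-< (w * d) (+<+ (n%d<d a d)))
      where
      shift : ∀ w d → d + w * d ≡ (w + 1ℤ) * d
      shift = solve-∀

  quotient-unique : ∀ {a k z} → InBracket +[1+ k ] z a → a ℤ./ +[1+ k ] ≡ z
  quotient-unique {a} {k} b = bracket-unique (+<+ (ℕ.s≤s ℕ.z≤n)) (quotient-bracket a k) b

  bracket-cancel : ∀ {d a z} g → InBracket (d * +[1+ g ]) z (a * +[1+ g ]) → InBracket d z a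
  bracket-cancel {d} {a} {z} g (lower , upper) =
      *-cancelʳ-≤-pos (z * d) a +[1+ g ] (subst (_≤ a * +[1+ g ]) (sym (*-assoc z d _)) lower)
    , *-cancelʳ-<-nonNeg +[1+ g ] (subst (a * +[1+ g ] <_) (sym (*-assoc (z + 1ℤ) d _)) upper)

  floor-bracket : ∀ p {z} → InBracket (↧ p) z (↥ p) → floor p ≡ z
  floor-bracket (mkℚ n k _) b = quotient-unique b

  -- For G > 0, ⌊F / G⌋ is the unique z with z·G ≤ F < (z+1)·G.  The normalised fraction
  -- has numerator and denominator F and G divided by gcd(F, G), which cancels from the bracket.
  floor-ratio : ∀ {F G z} → 0ℤ < G → InBracket G z F → floor (ratio F G) ≡ z
  floor-ratio {G = + zero} (+<+ ()) _
  floor-ratio {F} {+[1+ k ]} {z} _ b = cancel-gcd _ (↥-/ F (suc k)) (↧-/ F (suc k))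
    where
    p = F / suc k
    cancel-gcd : ∀ g → ↥ p * + g ≡ F → ↧ p * + g ≡ +[1+ k ] → floor p ≡ z
    cancel-gcd zero _ den = contradiction (trans (sym (*-zeroʳ (↧ p))) den) λ ()
    cancel-gcd (suc g) num den =
      floor-bracket p (bracket-cancel {↧ p} {↥ p} {z} g (subst₂ (λ d a → InBracket d z a) (sym den) (sym num) b))

  -- If T·F = (T·A + B)·G + s with 0 ≤ B < T and 0 ≤ s < G, then ⌊F / G⌋ = A:
  -- the error term B·G + s lies in [0, T·G), so T·A·G ≤ T·F < T·(A + 1)·G.
  scaled-bracket : ∀ t {G F A B s} → 0ℤ < G → +[1+ t ] * F ≡ (+[1+ t ] * A + B) * G + s →
                   0ℤ ≤ B → B < +[1+ t ] → 0ℤ ≤ s → s < G → InBracket G A F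
  scaled-bracket t {+ zero} (+<+ ()) _ _ _ _ _
  scaled-bracket t {G@(+[1+ g ])} {F} {A} {B} {s} _ eq 0≤B B<T 0≤s s<G =
      *-cancelˡ-≤-pos (A * G) F T lower
    , *-cancelˡ-<-nonNeg T upper
    where
    open ≤-Reasoning
    T = +[1+ t ]
    split : ∀ T A B G s → (T * A + B) * G + s ≡ T * (A * G) + (B * G + s)
    split = solve-∀
    step : ∀ T A G → T * (A * G) + T * G ≡ T * ((A + 1ℤ) * G)
    step = solve-∀
    eq′ : T * F ≡ T * (A * G) + (B * G + s)
    eq′ = trans eq (split T A B G s)
    error-nonneg : 0ℤ ≤ B * G + s
    error-nonneg = +-mono-≤ (subst (_≤ B * G) (*-zeroˡ G) (*-monoʳ-≤-nonNeg G 0≤B)) 0≤s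
    error-small : B * G + s < T * G
    error-small = begin-strict
      B * G + s     <⟨ +-monoʳ-< (B * G) s<G ⟩
      B * G + G     ≡⟨ trans (+-comm (B * G) G) (sym (suc-* B G)) ⟩
      ℤ.suc B * G   ≤⟨ *-monoʳ-≤-nonNeg G (i<j⇒suc[i]≤j B<T) ⟩
      T * G         ∎
    lower : T * (A * G) ≤ T * F
    lower = begin
      T * (A * G)                 ≡⟨ sym (+-identityʳ _) ⟩
      T * (A * G) + 0ℤ            ≤⟨ +-monoʳ-≤ (T * (A * G)) error-nonneg ⟩
      T * (A * G) + (B * G + s)   ≡⟨ sym eq′ ⟩
      T * F                       ∎
    upper : T * F < T * ((A + 1ℤ) * G)
    upper = begin-strict
      T * F                       ≡⟨ eq′ ⟩
      T * (A * G) + (B * G + s)   <⟨ +-monoʳ-< (T * (A * G)) error-small ⟩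
      T * (A * G) + T * G         ≡⟨ step T A G ⟩
      T * ((A + 1ℤ) * G)          ∎

  fraction-identity : ∀ A k z C R → (A - +[1+ k ] * z) * C ≡ R * +[1+ k ] →
                      ((A / suc k) ℚ.- (z / 1)) ℚ.* (C / 1) ≡ R / 1
  fraction-identity A k z C R eq = toℚᵘ-injective (begin
      ℚ.toℚᵘ (((A / suc k) ℚ.- (z / 1)) ℚ.* (C / 1))
        ≈⟨ toℚᵘ-homo-* ((A / suc k) ℚ.- (z / 1)) (C / 1) ⟩
      ℚ.toℚᵘ ((A / suc k) ℚ.- (z / 1)) ℚᵘ.* ℚ.toℚᵘ (C / 1)
        ≈⟨ ℚᵘP.*-cong (ℚᵘP.≃-trans (toℚᵘ-homo-+ (A / suc k) (ℚ.- (z / 1)))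
                         (ℚᵘP.+-cong (unnormalise A k)
                           (ℚᵘP.≃-trans (toℚᵘ-homo‿- (z / 1)) (ℚᵘP.-‿cong (unnormalise z 0)))))
                       (unnormalise C 0) ⟩
      (ℚᵘ.mkℚᵘ A k ℚᵘ.- ℚᵘ.mkℚᵘ z 0) ℚᵘ.* ℚᵘ.mkℚᵘ C 0
        ≈⟨ ℚᵘ.*≡* cross ⟩
      ℚᵘ.mkℚᵘ R 0
        ≈⟨ ℚᵘP.≃-sym (unnormalise R 0) ⟩
      ℚ.toℚᵘ (R / 1) ∎)
    where
    open ℚᵘP.≃-Reasoning
    unnormalise : ∀ a k → ℚ.toℚᵘ (a / suc k) ℚᵘ.≃ ℚᵘ.mkℚᵘ a k
    unnormalise a k = toℚᵘ-fromℚᵘ (ℚᵘ.mkℚᵘ a k)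
    expand : ∀ A z s C → ((A * 1ℤ + (- z) * s) * C) * 1ℤ ≡ (A - s * z) * C
    expand = solve-∀
    cross : ((A * 1ℤ + (- z) * +[1+ k ]) * C) * 1ℤ ≡ R * + (suc k ℕ.* 1 ℕ.* 1)
    cross = trans (expand A z +[1+ k ] C)
                  (trans eq (cong (λ t → R * + t) (sym (trans (ℕP.*-identityʳ (suc k ℕ.* 1)) (ℕP.*-identityʳ (suc k))))))

  frac-ratio : ∀ F G → G ≢ 0ℤ → frac (ratio F G) ℚ.* (G / 1) ≡ (F - G * floor (ratio F G)) / 1
  frac-ratio F (+ zero) G≢0 = contradiction refl G≢0
  frac-ratio F +[1+ k ] _ = fraction-identity F k z +[1+ k ] (F - +[1+ k ] * z) refl
    where z = floor (F / suc k)
  frac-ratio F -[1+ k ] _ = fraction-identity (- F) k z -[1+ k ] (F - -[1+ k ] * z) (swap-signs F +[1+ k ] z)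
    where
    z = floor ((- F) / suc k)
    swap-signs : ∀ F s z → ((- F) - s * z) * (- s) ≡ (F - (- s) * z) * s
    swap-signs = solve-∀

module PolynomialAlgebra where

  open import Data.Integer using (ℤ; 0ℤ; _+_; _*_; -_; _-_)
  open import Data.Integer.Properties using (+-identityˡ; +-identityʳ; *-zeroˡ; *-zeroʳ)
  open import Data.Integer.Tactic.RingSolver using (solve-∀)
  open import Data.List using ([]; _∷_; map)
  open import Relation.Binary.PropositionalEquality
  open ≡-Reasoning

  infixl 6 _⊕_ _⊖_
  infixl 7 _⊗_

  const : ℤ → Poly
  const a = a ∷ []

  eval-const : ∀ a x → eval (const a) x ≡ a
  eval-const a x = trans (cong (a +_) (*-zeroʳ x)) (+-identityʳ a)

  _⊕_ : Poly → Poly → Poly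
  [] ⊕ q = q
  (a ∷ p) ⊕ [] = a ∷ p
  (a ∷ p) ⊕ (b ∷ q) = (a + b) ∷ (p ⊕ q)

  eval-⊕ : ∀ p q x → eval (p ⊕ q) x ≡ eval p x + eval q x
  eval-⊕ [] q x = sym (+-identityˡ _)
  eval-⊕ (a ∷ p) [] x = sym (+-identityʳ _)
  eval-⊕ (a ∷ p) (b ∷ q) x = begin
    (a + b) + x * eval (p ⊕ q) x          ≡⟨ cong (λ t → (a + b) + x * t) (eval-⊕ p q x) ⟩
    (a + b) + x * (eval p x + eval q x)   ≡⟨ regroup a b x (eval p x) (eval q x) ⟩
    (a + x * eval p x) + (b + x * eval q x) ∎
    where
    regroup : ∀ a b x u v → (a + b) + x * (u + v) ≡ (a + x * u) + (b + x * v)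
    regroup = solve-∀

  scale : ℤ → Poly → Poly
  scale k = map (k *_)

  eval-scale : ∀ k p x → eval (scale k p) x ≡ k * eval p x
  eval-scale k [] x = sym (*-zeroʳ k)
  eval-scale k (a ∷ p) x = begin
    k * a + x * eval (scale k p) x   ≡⟨ cong (λ t → k * a + x * t) (eval-scale k p x) ⟩
    k * a + x * (k * eval p x)       ≡⟨ factor k a x (eval p x) ⟩
    k * (a + x * eval p x)           ∎
    where
    factor : ∀ k a x u → k * a + x * (k * u) ≡ k * (a + x * u)
    factor = solve-∀

  negate : Poly → Poly
  negate = map (λ a → - a)

  eval-negate : ∀ p x → eval (negate p) x ≡ - eval p x
  eval-negate [] x = refl
  eval-negate (a ∷ p) x = begin
    - a + x * eval (negate p) x   ≡⟨ cong (λ t → - a + x * t) (eval-negate p x) ⟩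
    - a + x * (- eval p x)        ≡⟨ factor a x (eval p x) ⟩
    - (a + x * eval p x)          ∎
    where
    factor : ∀ a x u → - a + x * (- u) ≡ - (a + x * u)
    factor = solve-∀

  _⊖_ : Poly → Poly → Poly
  p ⊖ q = p ⊕ negate q

  eval-⊖ : ∀ p q x → eval (p ⊖ q) x ≡ eval p x - eval q x
  eval-⊖ p q x = trans (eval-⊕ p (negate q) x) (cong (eval p x +_) (eval-negate q x))

  _⊗_ : Poly → Poly → Poly
  [] ⊗ q = []
  (a ∷ p) ⊗ q = scale a q ⊕ (0ℤ ∷ p ⊗ q)

  eval-⊗ : ∀ p q x → eval (p ⊗ q) x ≡ eval p x * eval q x
  eval-⊗ [] q x = sym (*-zeroˡ (eval q x))
  eval-⊗ (a ∷ p) q x = begin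
    eval (scale a q ⊕ (0ℤ ∷ p ⊗ q)) x                     ≡⟨ eval-⊕ (scale a q) (0ℤ ∷ p ⊗ q) x ⟩
    eval (scale a q) x + (0ℤ + x * eval (p ⊗ q) x)        ≡⟨ cong₂ (λ s t → s + (0ℤ + x * t)) (eval-scale a q x) (eval-⊗ p q x) ⟩
    a * eval q x + (0ℤ + x * (eval p x * eval q x))       ≡⟨ distribute a x (eval p x) (eval q x) ⟩
    (a + x * eval p x) * eval q x                         ∎
    where
    distribute : ∀ a x u v → a * v + (0ℤ + x * (u * v)) ≡ (a + x * u) * v
    distribute = solve-∀

  -- The divided difference along an arithmetic progression: for all x,
  --   q(i + T·x) = q(i) + T · (Δ T i q)(x).
  -- It exists because (i + T·x)^k − i^k is divisible by T.  By Horner's scheme, for a + y·q(y):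
  --   a + (i + T·x)·(q(i) + T·Δq(x)) = (a + i·q(i)) + T·(i·Δq(x) + x·(T·Δq(x) + q(i))).
  Δ : ℤ → ℤ → Poly → Poly
  Δ T i [] = []
  Δ T i (a ∷ q) = scale i (Δ T i q) ⊕ (0ℤ ∷ (scale T (Δ T i q) ⊕ const (eval q i)))

  eval-Δ : ∀ T i q x → eval q (i + T * x) ≡ eval q i + T * eval (Δ T i q) x
  eval-Δ T i [] x = sym (trans (+-identityˡ _) (*-zeroʳ T))
  eval-Δ T i (a ∷ q) x = begin
    a + (i + T * x) * eval q (i + T * x)   ≡⟨ cong (λ t → a + (i + T * x) * t) (eval-Δ T i q x) ⟩
    a + (i + T * x) * (Q + T * D)          ≡⟨ expand a i T x Q D ⟩
    (a + i * Q) + T * (i * D + (0ℤ + x * (T * D + Q)))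
      ≡⟨ cong (λ t → (a + i * Q) + T * t) (sym evalΔ) ⟩
    (a + i * Q) + T * eval (Δ T i (a ∷ q)) x ∎
    where
    Q = eval q i
    D = eval (Δ T i q) x
    expand : ∀ a i T x Q D → a + (i + T * x) * (Q + T * D) ≡ (a + i * Q) + T * (i * D + (0ℤ + x * (T * D + Q)))
    expand = solve-∀
    evalΔ : eval (Δ T i (a ∷ q)) x ≡ i * D + (0ℤ + x * (T * D + Q))
    evalΔ = begin
      eval (Δ T i (a ∷ q)) x
        ≡⟨ eval-⊕ (scale i (Δ T i q)) (0ℤ ∷ (scale T (Δ T i q) ⊕ const Q)) x ⟩
      eval (scale i (Δ T i q)) x + (0ℤ + x * eval (scale T (Δ T i q) ⊕ const Q) x)
        ≡⟨ cong₂ (λ s t → s + (0ℤ + x * t)) (eval-scale i (Δ T i q) x) (eval-⊕ (scale T (Δ T i q)) (const Q) x) ⟩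
      i * D + (0ℤ + x * (eval (scale T (Δ T i q)) x + eval (const Q) x))
        ≡⟨ cong₂ (λ s t → i * D + (0ℤ + x * (s + t))) (eval-scale T (Δ T i q) x) (eval-const Q x) ⟩
      i * D + (0ℤ + x * (T * D + Q)) ∎

  substitute : ℤ → ℤ → Poly → Poly
  substitute T i q = const (eval q i) ⊕ scale T (Δ T i q)

  eval-substitute : ∀ T i q x → eval (substitute T i q) x ≡ eval q (i + T * x)
  eval-substitute T i q x = begin
    eval (const (eval q i) ⊕ scale T (Δ T i q)) x               ≡⟨ eval-⊕ (const (eval q i)) (scale T (Δ T i q)) x ⟩
    eval (const (eval q i)) x + eval (scale T (Δ T i q)) x      ≡⟨ cong₂ _+_ (eval-const (eval q i) x) (eval-scale T (Δ T i q) x) ⟩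
    eval q i + T * eval (Δ T i q) x                             ≡⟨ sym (eval-Δ T i q x) ⟩
    eval q (i + T * x)                                          ∎

module BoundedDegree where

  open import Data.Nat as ℕ using (ℕ; zero; suc)
  import Data.Nat.Properties as ℕP
  open import Data.Integer as ℤ
    using (ℤ; +_; +[1+_]; -[1+_]; 0ℤ; 1ℤ; _+_; _*_; -_; _≤_; _<_; _^_; ∣_∣; +≤+; +<+; -≤+)
  open import Data.Integer.Properties
  open import Data.Integer.Tactic.RingSolver using (solve-∀)
  import Data.Nat.Tactic.RingSolver as ℕSolver
  open import Data.Product using (Σ; _×_; _,_; proj₂)
  open import Data.Sum using (_⊎_; inj₁; inj₂)
  open import Data.List using ([]; _∷_)
  open import Data.List.Relation.Unary.Any using (here; there; any?)
  open import Data.Vec as Vec using (Vec; []; _∷_; _∷ʳ_; init; last; initLast; toList)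
  open import Data.Vec.Properties using (toList-map)
  open import Relation.Binary.PropositionalEquality
  open import Relation.Nullary using (¬_; yes; no; ¬?; contradiction)
  open PolynomialAlgebra using (eval-negate)

  evalV : ∀ {d} → Vec ℤ d → ℤ → ℤ
  evalV v x = eval (toList v) x

  evalV-∷ʳ : ∀ {d} (v : Vec ℤ d) e x → evalV (v ∷ʳ e) x ≡ evalV v x + e * x ^ d
  evalV-∷ʳ [] e x = expand e x
    where
    expand : ∀ e x → e + x * 0ℤ ≡ 0ℤ + e * 1ℤ
    expand = solve-∀
  evalV-∷ʳ {suc d} (a ∷ v) e x =
    trans (cong (λ t → a + x * t) (evalV-∷ʳ v e x)) (expand a x (evalV v x) e (x ^ d))
    where
    expand : ∀ a x u e p → a + x * (u + e * p) ≡ (a + x * u) + e * (x * p)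
    expand = solve-∀

  evalV-init-last : ∀ {d} (v : Vec ℤ (suc d)) x → evalV v x ≡ evalV (init v) x + last v * x ^ d
  evalV-init-last v x = trans (cong (λ w → evalV w x) (proj₂ (proj₂ (initLast v)))) (evalV-∷ʳ (init v) (last v) x)

  evalV-negate : ∀ {d} (v : Vec ℤ d) x → evalV (Vec.map (λ a → - a) v) x ≡ - evalV v x
  evalV-negate v x = trans (cong (λ p → eval p x) (toList-map (λ a → - a) v)) (eval-negate (toList v) x)

  evalV-combine : ∀ {d} a b (v w : Vec ℤ d) x →
                  evalV (Vec.zipWith (λ s t → a * s + b * t) v w) x ≡ a * evalV v x + b * evalV w x
  evalV-combine a b [] [] x = vanish a b
    where
    vanish : ∀ a b → 0ℤ ≡ a * 0ℤ + b * 0ℤ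
    vanish = solve-∀
  evalV-combine a b (s ∷ v) (t ∷ w) x =
    trans (cong (λ u → a * s + b * t + x * u) (evalV-combine a b v w x))
          (regroup a b s t x (evalV v x) (evalV w x))
    where
    regroup : ∀ a b s t x u v → a * s + b * t + x * (a * u + b * v) ≡ a * (s + x * u) + b * (t + x * v)
    regroup = solve-∀

  norm : ∀ {d} → Vec ℤ d → ℕ
  norm v = Vec.sum (Vec.map ∣_∣ v)

  i≤∣i∣ : ∀ i → i ≤ + ∣ i ∣
  i≤∣i∣ (+ n) = ≤-refl
  i≤∣i∣ -[1+ n ] = -≤+

  -∣i∣≤i : ∀ i → - + ∣ i ∣ ≤ i
  -∣i∣≤i i = subst (- + ∣ i ∣ ≤_) (neg-involutive i)
    (neg-mono-≤ (subst (λ k → - i ≤ + k) (∣-i∣≡∣i∣ i) (i≤∣i∣ (- i))))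

  abs-bounds : ∀ {w G} → + ∣ w ∣ < G → - G < w × w < G
  abs-bounds {w} |w|<G = <-≤-trans (neg-mono-< |w|<G) (-∣i∣≤i w) , ≤-<-trans (i≤∣i∣ w) |w|<G

  -- On n ≥ 1, a polynomial of degree < d is bounded by its norm times n^(d-1);
  -- stated multiplied through by n to avoid the case d = 0.
  eval-bound : ∀ {d} (v : Vec ℤ d) n → ∣ evalV v (+ suc n) ∣ ℕ.* suc n ℕ.≤ norm v ℕ.* suc n ℕ.^ d
  eval-bound [] n = ℕ.z≤n
  eval-bound {suc d} (a ∷ v) n = begin
    ∣ a + + N * V ∣ ℕ.* N                 ≤⟨ ℕP.*-monoˡ-≤ N (∣i+j∣≤∣i∣+∣j∣ a (+ N * V)) ⟩
    (A ℕ.+ ∣ + N * V ∣) ℕ.* N             ≡⟨ cong (λ t → (A ℕ.+ t) ℕ.* N) (abs-* (+ N) V) ⟩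
    (A ℕ.+ N ℕ.* E) ℕ.* N                 ≡⟨ distribute A N E ⟩
    A ℕ.* N ℕ.+ N ℕ.* (E ℕ.* N)           ≤⟨ ℕP.+-mono-≤ (ℕP.*-monoʳ-≤ A (ℕP.m≤m*n N P))
                                                           (ℕP.*-monoʳ-≤ N (eval-bound v n)) ⟩
    A ℕ.* (N ℕ.* P) ℕ.+ N ℕ.* (norm v ℕ.* P) ≡⟨ collect A N P (norm v) ⟩
    (A ℕ.+ norm v) ℕ.* (N ℕ.* P)          ∎
    where
    open ℕP.≤-Reasoning
    N = suc n
    V = evalV v (+ N)
    A = ∣ a ∣
    E = ∣ V ∣
    P = N ℕ.^ d
    instance
      P≢0 : ℕ.NonZero P
      P≢0 = ℕP.m^n≢0 N d
    distribute : ∀ a N E → (a ℕ.+ N ℕ.* E) ℕ.* N ≡ a ℕ.* N ℕ.+ N ℕ.* (E ℕ.* N)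
    distribute = ℕSolver.solve-∀
    collect : ∀ a N P s → a ℕ.* (N ℕ.* P) ℕ.+ N ℕ.* (s ℕ.* P) ≡ (a ℕ.+ s) ℕ.* (N ℕ.* P)
    collect = ℕSolver.solve-∀

  pos-^ : ∀ n d → (+ n) ^ d ≡ + (n ℕ.^ d)
  pos-^ n zero = refl
  pos-^ n (suc d) = trans (cong (+ n *_) (pos-^ n d)) (sym (pos-* n (n ℕ.^ d)))

  posLead : ∀ {d} → Vec ℤ d → ℕ → ℤ → ℤ
  posLead {d} lo c x = evalV lo x + +[1+ c ] * x ^ d

  -- Multiplied by n: |w(n)|·n ≤ ‖w‖·n^d < −‖lo‖·n^d + n^d·n ≤ lo(n)·n + (c+1)·n^d·n.
  dominance : ∀ {d} (lo w : Vec ℤ d) c n → norm lo ℕ.+ norm w ℕ.< n → + ∣ evalV w (+ n) ∣ < posLead lo c (+ n)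
  dominance {d} lo w c (suc n) n>‖lo‖+‖w‖ = *-cancelʳ-<-nonNeg (+ N) (begin-strict
      + W * + N                         ≤⟨ w-bound ⟩
      + ‖w‖ * + P                       <⟨ subst (_< + ‖w‖ * + P + + P) (+-identityʳ _) (+-monoʳ-< (+ ‖w‖ * + P) P-pos) ⟩
      + ‖w‖ * + P + + P                 ≡⟨ rearrange (+ ‖lo‖) (+ ‖w‖) (+ P) ⟩
      - (+ ‖lo‖ * + P) + + P * (+ ‖lo‖ + + ‖w‖ + 1ℤ)
                                        ≤⟨ +-mono-≤ lo-bound lead-bound ⟩
      L * + N + C * + P * + N           ≡⟨ factor L C (+ P) (+ N) ⟩
      (L + C * + P) * + N               ≡⟨ cong (λ t → (L + C * t) * + N) (sym (pos-^ N d)) ⟩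
      posLead lo c (+ N) * + N          ∎)
    where
    open ≤-Reasoning
    N = suc n
    P = N ℕ.^ d
    L = evalV lo (+ N)
    W = ∣ evalV w (+ N) ∣
    ‖lo‖ = norm lo
    ‖w‖ = norm w
    C = +[1+ c ]
    rearrange : ∀ a b p → b * p + p ≡ - (a * p) + p * (a + b + 1ℤ)
    rearrange = solve-∀
    factor : ∀ L c p n → L * n + c * p * n ≡ (L + c * p) * n
    factor = solve-∀
    P-pos : 0ℤ < + P
    P-pos = +<+ (ℕP.m^n>0 N d)
    w-bound : + W * + N ≤ + ‖w‖ * + P
    w-bound = subst₂ _≤_ (pos-* W N) (pos-* ‖w‖ P) (+≤+ (eval-bound w n))
    lo-bound : - (+ ‖lo‖ * + P) ≤ L * + N
    lo-bound = ≤-trans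
      (neg-mono-≤ (subst₂ _≤_ (cong +_ (sym (abs-* L (+ N)))) (pos-* ‖lo‖ P) (+≤+ (eval-bound lo n))))
      (-∣i∣≤i (L * + N))
    lead-bound : + P * (+ ‖lo‖ + + ‖w‖ + 1ℤ) ≤ C * + P * + N
    lead-bound = begin
      + P * (+ ‖lo‖ + + ‖w‖ + 1ℤ)       ≡⟨ cong (+ P *_) (trans (cong (_+ 1ℤ) (sym (pos-+ ‖lo‖ ‖w‖))) (sym (pos-+ (‖lo‖ ℕ.+ ‖w‖) 1))) ⟩
      + P * + (‖lo‖ ℕ.+ ‖w‖ ℕ.+ 1)      ≤⟨ *-monoˡ-≤-nonNeg (+ P) (+≤+ (subst (ℕ._≤ N) (ℕP.+-comm 1 (‖lo‖ ℕ.+ ‖w‖)) n>‖lo‖+‖w‖)) ⟩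
      + P * + N                         ≡⟨ trans (sym (pos-* P N)) (sym (*-identityˡ _)) ⟩
      1ℤ * + (P ℕ.* N)                  ≤⟨ *-monoʳ-≤-nonNeg (+ (P ℕ.* N)) (+≤+ (ℕ.s≤s (ℕ.z≤n {c}))) ⟩
      C * + (P ℕ.* N)                   ≡⟨ trans (cong (C *_) (pos-* P N)) (sym (*-assoc C (+ P) (+ N))) ⟩
      C * + P * + N                     ∎

  posLead-positive : ∀ {d} (lo : Vec ℤ d) c n → norm lo ℕ.+ norm lo ℕ.< n → 0ℤ < posLead lo c (+ n)
  posLead-positive lo c n n>2‖lo‖ = ≤-<-trans (+≤+ ℕ.z≤n) (dominance lo lo c n n>2‖lo‖)

  eval-zero-poly : ∀ (g : Poly) → ¬ NonZeroPoly g → ∀ x → eval g x ≡ 0ℤ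
  eval-zero-poly [] _ x = refl
  eval-zero-poly (a ∷ g) all-zero x with a ℤ.≟ 0ℤ
  ... | yes refl = trans (+-identityˡ _) (trans (cong (x *_) (eval-zero-poly g (λ p → all-zero (there p)) x)) (*-zeroʳ x))
  ... | no a≢0 = contradiction (here a≢0) all-zero

  leading-form : (g : Poly) → NonZeroPoly g →
                 Σ ℕ λ d → Σ (Vec ℤ d) λ lo → Σ ℤ λ c → c ≢ 0ℤ × (∀ x → eval g x ≡ evalV lo x + c * x ^ d)
  leading-form (a ∷ g) g≢0 with any? (λ c → ¬? (c ℤ.≟ 0ℤ)) g
  ... | yes tail≢0 =
    let d , lo , c , c≢0 , g≡ = leading-form g tail≢0 in
    suc d , a ∷ lo , c , c≢0 ,
    λ x → trans (cong (λ t → a + x * t) (g≡ x)) (shift-up a x (evalV lo x) c (x ^ d))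
    where
    shift-up : ∀ a x u c p → a + x * (u + c * p) ≡ (a + x * u) + c * (x * p)
    shift-up = solve-∀
  leading-form (a ∷ g) (here a≢0) | no tail≡0 =
    0 , [] , a , a≢0 , λ x → trans (cong (λ t → a + x * t) (eval-zero-poly g tail≡0 x)) (constant a x)
    where
    constant : ∀ a x → a + x * 0ℤ ≡ 0ℤ + a * 1ℤ
    constant = solve-∀
  leading-form (a ∷ g) (there tail≢0) | no tail≡0 = contradiction tail≢0 tail≡0

  negate-negative-lead : ∀ {d} (lo : Vec ℤ d) c x →
                         - (evalV lo x + -[1+ c ] * x ^ d) ≡ posLead (Vec.map (λ a → - a) lo) c x
  negate-negative-lead {d} lo c x =
    trans (flip (evalV lo x) +[1+ c ] (x ^ d)) (cong (_+ +[1+ c ] * x ^ d) (sym (evalV-negate lo x)))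
    where
    flip : ∀ u s p → - (u + (- s) * p) ≡ - u + s * p
    flip = solve-∀

  EventualSign : (ℕ → ℤ) → Set
  EventualSign h = Σ ℕ λ N → (∀ n → N ℕ.≤ n → 0ℤ ≤ h n) ⊎ (∀ n → N ℕ.≤ n → h n < 0ℤ)

  eventual-sign : (r : Poly) → EventualSign (λ n → eval r (+ n))
  eventual-sign r with any? (λ c → ¬? (c ℤ.≟ 0ℤ)) r
  ... | no r≡0 = 0 , inj₁ (λ n _ → ≤-reflexive (sym (eval-zero-poly r r≡0 (+ n))))
  ... | yes r≢0 with leading-form r r≢0
  ...   | d , lo , + zero , c≢0 , _ = contradiction refl c≢0
  ...   | d , lo , +[1+ c ] , _ , r≡ =
    suc (norm lo ℕ.+ norm lo) , inj₁ λ n n≥N → <⇒≤ (subst (0ℤ <_) (sym (r≡ (+ n))) (posLead-positive lo c n n≥N))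
  ...   | d , lo , -[1+ c ] , _ , r≡ =
    suc (norm lo⁻ ℕ.+ norm lo⁻) , inj₂ λ n n≥N → neg-cancel-< (subst (0ℤ <_) (sym (negated n)) (posLead-positive lo⁻ c n n≥N))
    where
    lo⁻ = Vec.map (λ a → - a) lo
    negated : ∀ n → - eval r (+ n) ≡ posLead lo⁻ c (+ n)
    negated n = trans (cong -_ (r≡ (+ n))) (negate-negative-lead lo c (+ n))

module PseudoDivision where

  open import Data.Nat as ℕ using (ℕ; zero; suc)
  open import Data.Integer as ℤ using (ℤ; +_; +[1+_]; 0ℤ; _+_; _*_; -_; _^_)
  open import Data.Integer.Properties using (pos-*; +-identityˡ; *-zeroʳ)
  open import Data.Integer.Tactic.RingSolver using (solve-∀)
  open import Data.Product using (Σ; _,_)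
  open import Data.List using ([]; _∷_)
  open import Data.Vec as Vec using (Vec; []; _∷_; init; last)
  open import Relation.Binary.PropositionalEquality
  open ≡-Reasoning
  open PolynomialAlgebra using (scale; eval-scale)
  open BoundedDegree using (evalV; evalV-init-last; evalV-combine; posLead)

  -- Reducing the top coefficient e of a polynomial R of degree ≤ d modulo G = glo + C·x^d:
  -- C·R = e·G + R′ with deg R′ < d, namely R′ = C·(R − e·x^d) − e·glo.
  reduce : ∀ {d} → Vec ℤ d → ℤ → Vec ℤ (suc d) → Vec ℤ d
  reduce glo C R = Vec.zipWith (λ s t → C * s + (- last R) * t) (init R) glo

  eval-reduce : ∀ {d} (glo : Vec ℤ d) C R x →
                C * evalV R x ≡ last R * (evalV glo x + C * x ^ d) + evalV (reduce glo C R) x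
  eval-reduce {d} glo C R x = begin
    C * evalV R x                                   ≡⟨ cong (C *_) (evalV-init-last R x) ⟩
    C * (evalV (init R) x + e * x ^ d)              ≡⟨ regroup C e (evalV (init R) x) (evalV glo x) (x ^ d) ⟩
    e * (evalV glo x + C * x ^ d) + (C * evalV (init R) x + (- e) * evalV glo x)
      ≡⟨ cong (_+_ (e * (evalV glo x + C * x ^ d))) (sym (evalV-combine C (- e) (init R) glo x)) ⟩
    e * (evalV glo x + C * x ^ d) + evalV (reduce glo C R) x ∎
    where
    e = last R
    regroup : ∀ C e u g p → C * (u + e * p) ≡ e * (g + C * p) + (C * u + (- e) * g)
    regroup = solve-∀

  evalV-zeros : ∀ d x → evalV (Vec.replicate d 0ℤ) x ≡ 0ℤ
  evalV-zeros zero x = refl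
  evalV-zeros (suc d) x = trans (cong (λ u → 0ℤ + x * u) (evalV-zeros d x)) (trans (+-identityˡ _) (*-zeroʳ x))

  PseudoQuotient : ∀ {d} → Vec ℤ d → ℕ → Poly → Set
  PseudoQuotient {d} glo c f =
    Σ ℕ λ t → Σ Poly λ q → Σ (Vec ℤ d) λ r → ∀ x → +[1+ t ] * eval f x ≡ eval q x * posLead glo c x + evalV r x

  -- By Horner's scheme in f: from (t+1)·f = q·G + r, the polynomial a + x·f satisfies
  -- (t+1)·(a + x·f) = x·q·G + R with R = (t+1)·a + x·r of degree ≤ d, and reducing R
  -- multiplies everything by the leading coefficient c+1.
  pseudo-divide : ∀ {d} (glo : Vec ℤ d) c f → PseudoQuotient glo c f
  pseudo-divide {d} glo c [] =
    0 , [] , Vec.replicate d 0ℤ , λ x → trans (*-zeroʳ (+ 1)) (sym (trans (+-identityˡ _) (evalV-zeros d x)))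
  pseudo-divide {d} glo c (a ∷ f) =
    let t , q , r , divides = pseudo-divide glo c f
        T = +[1+ t ]
        C = +[1+ c ]
        R = (T * a) ∷ r
    in
    t ℕ.+ c ℕ.* suc t , last R ∷ scale C q , reduce glo C R , λ x →
    let G = posLead glo c x in begin
      + (suc c ℕ.* suc t) * (a + x * eval f x)    ≡⟨ cong (_* (a + x * eval f x)) (pos-* (suc c) (suc t)) ⟩
      C * T * (a + x * eval f x)                  ≡⟨ distribute C T a x (eval f x) ⟩
      C * (T * a + x * (T * eval f x))            ≡⟨ cong (λ u → C * (T * a + x * u)) (divides x) ⟩
      C * (T * a + x * (eval q x * G + evalV r x)) ≡⟨ separate C T a x (eval q x) G (evalV r x) ⟩
      C * (x * eval q x) * G + C * evalV R x      ≡⟨ cong (_+_ (C * (x * eval q x) * G)) (eval-reduce glo C R x) ⟩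
      C * (x * eval q x) * G + (last R * G + evalV (reduce glo C R) x)
        ≡⟨ collect C x (eval q x) G (last R) (evalV (reduce glo C R) x) ⟩
      (last R + x * (C * eval q x)) * G + evalV (reduce glo C R) x
        ≡⟨ cong (λ u → (last R + x * u) * G + evalV (reduce glo C R) x) (sym (eval-scale C q x)) ⟩
      eval (last R ∷ scale C q) x * G + evalV (reduce glo C R) x ∎
    where
    distribute : ∀ C T a x F → C * T * (a + x * F) ≡ C * (T * a + x * (T * F))
    distribute = solve-∀
    separate : ∀ C T a x Q G r → C * (T * a + x * (Q * G + r)) ≡ C * (x * Q) * G + C * (T * a + x * r)
    separate = solve-∀
    collect : ∀ C x Q G e r → C * (x * Q) * G + (e * G + r) ≡ (e + x * (C * Q)) * G + r
    collect = solve-∀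

module EventualDivision where

  open import Data.Nat as ℕ using (ℕ; suc)
  import Data.Nat.Properties as ℕP
  open import Data.Integer as ℤ using (ℤ; +_; +[1+_]; 0ℤ; -1ℤ; _+_; _*_; -_; _≤_; _<_)
  open import Data.Integer.Properties
  open import Data.Integer.Tactic.RingSolver using (solve-∀)
  open import Data.Product using (Σ; _×_; _,_; proj₁; proj₂)
  open import Data.Sum using (inj₁; inj₂)
  open import Data.Vec using (Vec; toList)
  open import Relation.Binary.PropositionalEquality
  open PolynomialAlgebra using (_⊕_; const; eval-⊕; eval-const)
  open BoundedDegree
  open PseudoDivision

  EventualDivision : ∀ {d} → Vec ℤ d → ℕ → Poly → Set
  EventualDivision glo c f =
    Σ ℕ λ t → Σ Poly λ Q → Σ ℕ λ N → ∀ n → N ℕ.≤ n →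
      Σ ℤ λ s → +[1+ t ] * eval f (+ n) ≡ eval Q (+ n) * posLead glo c (+ n) + s
                × 0ℤ ≤ s × s < posLead glo c (+ n)

  -- Pseudo-divide f by G; the remainder r then satisfies −G(n) < r(n) < G(n) eventually
  -- (dominance) and has eventually constant sign.  If r is eventually negative,
  -- borrow one G from the quotient: q·G + r = (q − 1)·G + (r + G).
  eventual-division : ∀ {d} (glo : Vec ℤ d) c f → EventualDivision glo c f
  eventual-division glo c f with pseudo-divide glo c f
  ... | t , q , r , divides = with-sign (eventual-sign (toList r))
    where
    N₀ = suc (norm glo ℕ.+ norm r)
    r-small : ∀ {n} → N₀ ℕ.≤ n → - posLead glo c (+ n) < evalV r (+ n) × evalV r (+ n) < posLead glo c (+ n)
    r-small {n} n≥N₀ = abs-bounds (dominance glo r c n n≥N₀)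
    borrow : ∀ Q G R → Q * G + R ≡ (Q + -1ℤ) * G + (R + G)
    borrow = solve-∀
    with-sign : EventualSign (λ n → evalV r (+ n)) → EventualDivision glo c f
    with-sign (Nr , inj₁ r≥0) = t , q , N₀ ℕ.+ Nr , λ n n≥N →
      evalV r (+ n) , divides (+ n) , r≥0 n (ℕP.m+n≤o⇒n≤o N₀ n≥N) , proj₂ (r-small (ℕP.m+n≤o⇒m≤o N₀ n≥N))
    with-sign (Nr , inj₂ r<0) = t , q ⊕ const -1ℤ , N₀ ℕ.+ Nr , λ n n≥N →
      let G = posLead glo c (+ n)
          R = evalV r (+ n)
          Q-1≡ = trans (eval-⊕ q (const -1ℤ) (+ n)) (cong (_+_ (eval q (+ n))) (eval-const -1ℤ (+ n)))
      in
      R + G ,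
      trans (divides (+ n)) (trans (borrow (eval q (+ n)) G R) (cong (λ u → u * G + (R + G)) (sym Q-1≡))) ,
      <⇒≤ (subst (_< R + G) (+-inverseˡ G) (+-monoˡ-< G (proj₁ (r-small (ℕP.m+n≤o⇒m≤o N₀ n≥N))))) ,
      subst (R + G <_) (+-identityˡ G) (+-monoˡ-< G (r<0 n (ℕP.m+n≤o⇒n≤o N₀ n≥N)))

module FloorPolynomials where

  open import Data.Nat as ℕ using (ℕ; suc; NonZero; _≥_)
  import Data.Nat.Properties as ℕP
  open import Data.Integer as ℤ using (ℤ; +_; +[1+_]; -[1+_]; 0ℤ; _+_; _*_; -_; _-_; _<_; +≤+; +<+)
  open import Data.Integer.Properties
  open import Data.Integer.DivMod using (a≡a%n+[a/n]*n; n%d<d)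
  open import Data.Integer.Tactic.RingSolver using (solve-∀)
  open import Data.Fin using (Fin; toℕ)
  open import Data.Rational as ℚ using (floor; _/_)
  open import Data.Product using (Σ; _×_; _,_; proj₂)
  open import Data.Vec as Vec using (Vec)
  open import Relation.Binary.PropositionalEquality
  open import Relation.Nullary using (contradiction)
  open IntegerFloor
  open PolynomialAlgebra
  open BoundedDegree using (posLead; leading-form; negate-negative-lead)
  open EventualDivision

  progression : ∀ T m i → + (T ℕ.* m ℕ.+ i) ≡ + i + + T * + m
  progression T m i = trans (pos-+ (T ℕ.* m) i) (trans (cong (_+ + i) (pos-* T m)) (+-comm (+ T * + m) (+ i)))

  FloorAt : Poly → Poly → (T : ℕ) → (Fin T → Poly) → ℕ → Fin T → Set
  FloorAt f g T p m i =
    eval g (+ n) ≢ 0ℤ × eval (p i) (+ m) ≡ floor (ratio (eval f (+ n)) (eval g (+ n)))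
    where n = T ℕ.* m ℕ.+ toℕ i

  FloorPolynomials : Poly → Poly → Set
  FloorPolynomials f g =
    Σ ℕ λ T → NonZero T × Σ (Fin T → Poly) λ p → Σ ℕ λ N →
      ∀ m (i : Fin T) → T ℕ.* m ℕ.+ toℕ i ≥ N → FloorAt f g T p m i

  -- With T·f(n) = Q(n)·g(n) + s, 0 ≤ s < g(n),
  -- write Q(i + T·m) = Q(i) + T·ΔQ(m) and Q(i) = T·aᵢ + bᵢ with 0 ≤ bᵢ < T; then
  -- T·f(n) = (T·(ΔQ(m) + aᵢ) + bᵢ)·g(n) + s, so ⌊f(n)/g(n)⌋ = ΔQ(m) + aᵢ.
  floor-polynomials-posLead : ∀ f g {d} (glo : Vec ℤ d) c → (∀ x → eval g x ≡ posLead glo c x) → FloorPolynomials f g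
  floor-polynomials-posLead f g glo c g≡ with eventual-division glo c f
  ... | t , Q , N , divides = suc t , _ , p , N , on-class
    where
    T = +[1+ t ]
    a : Fin (suc t) → ℤ
    a i = eval Q (+ toℕ i) ℤ./ T
    b : Fin (suc t) → ℤ
    b i = + (eval Q (+ toℕ i) ℤ.% T)
    p : Fin (suc t) → Poly
    p i = Δ T (+ toℕ i) Q ⊕ const (a i)
    on-class : ∀ m i → suc t ℕ.* m ℕ.+ toℕ i ≥ N → FloorAt f g (suc t) p m i
    on-class m i n≥N with divides (suc t ℕ.* m ℕ.+ toℕ i) n≥N
    ... | s , T·f≡ , 0≤s , s<G = G≢0 , p-is-floor
      where
      n = suc t ℕ.* m ℕ.+ toℕ i
      F = eval f (+ n)
      G = eval g (+ n)
      D = eval (Δ T (+ toℕ i) Q) (+ m)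
      0<G : 0ℤ < G
      0<G = subst (0ℤ <_) (sym (g≡ (+ n))) (≤-<-trans 0≤s s<G)
      G≢0 : G ≢ 0ℤ
      G≢0 G≡0 = <-irrefl (sym G≡0) 0<G
      Q-at-n : eval Q (+ n) ≡ T * D + b i + a i * T
      Q-at-n = begin
        eval Q (+ n)                              ≡⟨ cong (eval Q) (progression (suc t) m (toℕ i)) ⟩
        eval Q (+ toℕ i + T * + m)                ≡⟨ eval-Δ T (+ toℕ i) Q (+ m) ⟩
        eval Q (+ toℕ i) + T * D                  ≡⟨ cong (_+ T * D) (a≡a%n+[a/n]*n (eval Q (+ toℕ i)) T) ⟩
        b i + a i * T + T * D                     ≡⟨ reorder (b i) (a i) T D ⟩
        T * D + b i + a i * T                     ∎
        where
        open ≡-Reasoning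
        reorder : ∀ b a T D → b + a * T + T * D ≡ T * D + b + a * T
        reorder = solve-∀
      euclid : T * F ≡ (T * (D + a i) + b i) * G + s
      euclid = begin
        T * F                                     ≡⟨ T·f≡ ⟩
        eval Q (+ n) * posLead glo c (+ n) + s    ≡⟨ cong₂ (λ u v → u * v + s) Q-at-n (sym (g≡ (+ n))) ⟩
        (T * D + b i + a i * T) * G + s           ≡⟨ regroup T D (a i) (b i) G s ⟩
        (T * (D + a i) + b i) * G + s             ∎
        where
        open ≡-Reasoning
        regroup : ∀ T D a b G s → (T * D + b + a * T) * G + s ≡ (T * (D + a) + b) * G + s
        regroup = solve-∀
      in-bracket : InBracket G (D + a i) F
      in-bracket = scaled-bracket t {A = D + a i} {B = b i} 0<G euclid (+≤+ ℕ.z≤n) (+<+ (n%d<d (eval Q (+ toℕ i)) T)) 0≤s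
                                  (subst (s <_) (sym (g≡ (+ n))) s<G)
      p-value : eval (p i) (+ m) ≡ D + a i
      p-value = trans (eval-⊕ (Δ T (+ toℕ i) Q) (const (a i)) (+ m)) (cong (_+_ D) (eval-const (a i) (+ m)))
      p-is-floor : eval (p i) (+ m) ≡ floor (ratio F G)
      p-is-floor = trans p-value (sym (floor-ratio 0<G in-bracket))

  ratio-negate : ∀ a b → ratio (- a) (- b) ≡ ratio a b
  ratio-negate a (+ 0) = refl
  ratio-negate a +[1+ k ] = cong (_/ suc k) (neg-involutive a)
  ratio-negate a -[1+ k ] = refl

  floor-polynomials-negate : ∀ f g → FloorPolynomials (negate f) (negate g) → FloorPolynomials f g
  floor-polynomials-negate f g (T , T≢0 , p , N , floor-at) = T , T≢0 , p , N , λ m i n≥N →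
    let n = T ℕ.* m ℕ.+ toℕ i
        -g≢0 , p-is-floor = floor-at m i n≥N
    in
      (λ g≡0 → -g≢0 (trans (eval-negate g (+ n)) (cong -_ g≡0)))
    , trans p-is-floor (trans (cong₂ (λ u v → floor (ratio u v)) (eval-negate f (+ n)) (eval-negate g (+ n)))
                              (cong floor (ratio-negate (eval f (+ n)) (eval g (+ n)))))

  floor-polynomials : ∀ f g → NonZeroPoly g → FloorPolynomials f g
  floor-polynomials f g g≢0 with leading-form g g≢0
  ... | d , lo , + 0 , c≢0 , _ = contradiction refl c≢0
  ... | d , lo , +[1+ c ] , _ , g≡ = floor-polynomials-posLead f g lo c g≡
  ... | d , lo , -[1+ c ] , _ , g≡ =
    floor-polynomials-negate f g
      (floor-polynomials-posLead (negate f) (negate g) (Vec.map (λ a → - a) lo) c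
        (λ x → trans (eval-negate g x) (trans (cong -_ (g≡ x)) (negate-negative-lead lo c x))))

  FloorAndRemainderPolynomials : Poly → Poly → Set
  FloorAndRemainderPolynomials f g =
    Σ ℕ λ T → NonZero T × Σ (Fin T → Poly) λ p → Σ (Fin T → Poly) λ r →
      Σ ℕ λ N → (m : ℕ) (i : Fin T) → T ℕ.* m ℕ.+ toℕ i ≥ N →
        (eval (p i) (+ m) ≡ floor (ratio (eval f (+ (T ℕ.* m ℕ.+ toℕ i))) (eval g (+ (T ℕ.* m ℕ.+ toℕ i)))))
        × ((eval (r i) (+ m) / 1) ≡ frac (ratio (eval f (+ (T ℕ.* m ℕ.+ toℕ i))) (eval g (+ (T ℕ.* m ℕ.+ toℕ i)))) ℚ.* (eval g (+ (T ℕ.* m ℕ.+ toℕ i)) / 1))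

  remainder-polynomials : ∀ f g → FloorPolynomials f g → FloorAndRemainderPolynomials f g
  remainder-polynomials f g (T , T≢0 , p , N , floor-at) = T , T≢0 , p , r , N , λ m i n≥N →
    proj₂ (floor-at m i n≥N) , remainder-is-frac m i (floor-at m i n≥N)
    where
    r : Fin T → Poly
    r i = substitute (+ T) (+ toℕ i) f ⊖ substitute (+ T) (+ toℕ i) g ⊗ p i
    remainder-is-frac : ∀ m i → FloorAt f g T p m i →
      let n = T ℕ.* m ℕ.+ toℕ i in
      eval (r i) (+ m) / 1 ≡ frac (ratio (eval f (+ n)) (eval g (+ n))) ℚ.* (eval g (+ n) / 1)
    remainder-is-frac m i (G≢0 , p-is-floor) =
      trans (cong (_/ 1) r-value) (sym (frac-ratio (eval f (+ n)) (eval g (+ n)) G≢0))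
      where
      n = T ℕ.* m ℕ.+ toℕ i
      at-n : ∀ h → eval (substitute (+ T) (+ toℕ i) h) (+ m) ≡ eval h (+ n)
      at-n h = trans (eval-substitute (+ T) (+ toℕ i) h (+ m)) (cong (eval h) (sym (progression T m (toℕ i))))
      r-value : eval (r i) (+ m) ≡ eval f (+ n) - eval g (+ n) * floor (ratio (eval f (+ n)) (eval g (+ n)))
      r-value = begin
        eval (r i) (+ m)
          ≡⟨ eval-⊖ (substitute (+ T) (+ toℕ i) f) (substitute (+ T) (+ toℕ i) g ⊗ p i) (+ m) ⟩
        eval (substitute (+ T) (+ toℕ i) f) (+ m) - eval (substitute (+ T) (+ toℕ i) g ⊗ p i) (+ m)
          ≡⟨ cong₂ _-_ (at-n f) (trans (eval-⊗ (substitute (+ T) (+ toℕ i) g) (p i) (+ m)) (cong₂ _*_ (at-n g) p-is-floor)) ⟩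
        eval f (+ n) - eval g (+ n) * floor (ratio (eval f (+ n)) (eval g (+ n))) ∎
        where open ≡-Reasoning

open import Data.Nat using (ℕ; _+_; _*_; _≥_; NonZero)
open import Data.Fin using (Fin; toℕ)
open import Data.Integer using (+_)
open import Data.Rational as ℚ using (floor; _/_)
open import Data.Product using (Σ; _×_)
open import Relation.Binary.PropositionalEquality using (_≡_)
open FloorPolynomials using (floor-polynomials; remainder-polynomials)

theorem4p1 : (f g : Poly) → NonZeroPoly g →
    Σ ℕ λ T → NonZero T × Σ (Fin T → Poly) λ p → Σ (Fin T → Poly) λ r →
      Σ ℕ λ N → (m : ℕ) (i : Fin T) → T * m + toℕ i ≥ N →
        (eval (p i) (+ m) ≡ floor (ratio (eval f (+ (T * m + toℕ i))) (eval g (+ (T * m + toℕ i)))))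
        × ((eval (r i) (+ m) / 1) ≡ frac (ratio (eval f (+ (T * m + toℕ i))) (eval g (+ (T * m + toℕ i)))) ℚ.* (eval g (+ (T * m + toℕ i)) / 1))
theorem4p1 f g g≢0 = remainder-polynomials f g (floor-polynomials f g g≢0)
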